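{- Let $k\ge1$, $\mathbf t=(t_1,\dots,t_k)\in\mathbb Z^k$ with $t_k\ne0$, $\mathcal C(X)=X^k-t_1X^{k-1}-\dots-t_k$ with companion matrix $\mathbf A$ (rows $1,\dots,k-1$ equal to $e_2,\dots,e_k$, last row $(t_k,\dots,t_1)$). Let $\mathbf d=(d_0,\dots,d_{k-1})$ be the coefficient vector of the derivative $\mathcal C'(X)=\sum_{j=0}^{k-1}d_jX^j$. Then for every $n\in\mathbb Z$, the last ($k$-th) coordinate of the row vector $\mathbf d\mathbf A^n$ equals $G_{k,n}(\mathbf t)$. (Consequently the same holds modulo any prime $p\nmid t_k$.)
   Context: $G_{k,n}(\mathbf t)=\sum_{i=1}^k\lambda_i^n$ where $\lambda_1,\dots,\lambda_k$ are the roots of $\mathcal C$ with multiplicity (Generalized Lucas Polynomials). The vectors $\mathbf d\mathbf A^n$, $n\in\mathbb Z$, are the rows of the orbit of the standard matrix of $\mathcal C'(\lambda)$ under the group generated by $\mathbf A$; the statement says the right-hand column of this orbit is the sequence of $G_{k,n}$. -}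

module Defs where

open import Level using (Level; _⊔_) renaming (suc to lsuc)
open import Algebra.Bundles using (CommutativeRing)
open import Data.Nat as ℕ using (ℕ; zero; suc)
open import Data.Integer as ℤ using (ℤ; +_; -[1+_])
open import Data.Fin using (Fin; toℕ; fromℕ)
open import Data.Vec using (Vec; []; _∷_; lookup; tabulate; reverse; map; zipWith; _∷ʳ_; tail)
open import Data.Bool using (if_then_else_)
open import Relation.Nullary using (¬_; does)

-- Integer polynomial data attached to t = (t₁,…,t_k)  (t₁ stored at index 0)

-- Coefficient vector (coefficient of X^j at index j) of
--   C(X) = X^k - t₁X^{k-1} - … - t_k,  i.e.  (-t_k, …, -t₁, 1).
Ccoeffs : ∀ {k} → Vec ℤ k → Vec ℤ (suc k)
Ccoeffs t = reverse (+ 1 ∷ map ℤ.-_ t)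

deriv : ∀ {k} → Vec ℤ (suc k) → Vec ℤ k
deriv c = tabulate (λ j → + suc (toℕ j) ℤ.* lookup (tail c) j)

record Field (c ℓ : Level) : Set (lsuc (c ⊔ ℓ)) where
  field
    commutativeRing : CommutativeRing c ℓ
  open CommutativeRing commutativeRing public
  field
    _⁻¹ : Carrier → Carrier
    1≉0 : ¬ (1# ≈ 0#)
    ⁻¹-inverseʳ : ∀ x → ¬ (x ≈ 0#) → (x * (x ⁻¹)) ≈ 1#

module _ {c ℓ : Level} (F : Field c ℓ) where
  open Field F

  natCast : ℕ → Carrier
  natCast zero = 0#
  natCast (suc n) = 1# + natCast n

  intCast : ℤ → Carrier
  intCast (+ n) = natCast n
  intCast -[1+ n ] = - natCast (suc n)

  CharZero : Set ℓ
  CharZero = ∀ n → ¬ (natCast (suc n) ≈ 0#)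

  pow : Carrier → ℕ → Carrier
  pow x zero = 1#
  pow x (suc n) = x * pow x n

  zpow : Carrier → ℤ → Carrier
  zpow x (+ n) = pow x n
  zpow x -[1+ n ] = pow (x ⁻¹) (suc n)

  sumFin : ∀ {n} → (Fin n → Carrier) → Carrier
  sumFin {zero} f = 0#
  sumFin {suc n} f = f Fin.zero + sumFin (λ i → f (Fin.suc i))
    where import Data.Fin as Fin

  -- multiply a coefficient vector by (X - a)
  xMinus : ∀ {m} → Carrier → Vec Carrier (suc m) → Vec Carrier (suc (suc m))
  xMinus a p = zipWith _+_ (0# ∷ p) (map (λ x → (- a) * x) p ∷ʳ 0#)

  linProd : ∀ {k} → Vec Carrier k → Vec Carrier (suc k)
  linProd [] = 1# ∷ []
  linProd (a ∷ as) = xMinus a (linProd as)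

  -- λ₁,…,λ_k are the roots of C with multiplicity: C(X) = ∏ (X - λᵢ) in F[X]
  IsRootVector : ∀ {k} → Vec ℤ k → Vec Carrier k → Set ℓ
  IsRootVector t ls = ∀ j → lookup (linProd ls) j ≈ intCast (lookup (Ccoeffs t) j)

  companion : ∀ {k} → Vec ℤ k → Fin k → Fin k → Carrier
  companion {k} t i j =
    if does (suc (toℕ i) ℕ.≟ k)
    then intCast (lookup (reverse t) j)
    else (if does (toℕ j ℕ.≟ suc (toℕ i)) then 1# else 0#)

  rowMul : ∀ {k} → (Fin k → Carrier) → (Fin k → Fin k → Carrier) → Fin k → Carrier
  rowMul v M j = sumFin (λ i → v i * M i j)

  IsOrbit : ∀ {k} → Vec ℤ k → (ℤ → Fin k → Carrier) → Set ℓ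
  IsOrbit t w =
    (∀ j → w (+ 0) j ≈ intCast (lookup (deriv (Ccoeffs t)) j)) ×'
    (∀ n j → w (n ℤ.+ + 1) j ≈ rowMul (w n) (companion t) j)
    where open import Data.Product using () renaming (_×_ to _×'_)

  -- G_{k,n} = Σᵢ λᵢⁿ
  powerSum : ∀ {k} → Vec Carrier k → ℤ → Carrier
  powerSum ls n = sumFin (λ i → zpow (lookup ls i) n)

{-# OPTIONS --safe #-}
-- Identify a row vector u ∈ Fᵏ with the polynomial Σⱼ uⱼ Xʲ of degree < k. Then u ↦ u A is
-- multiplication by X modulo C, and d is C'. With C = ∏ᵢ (X − λᵢ), the polynomials
-- Sₙ = Σᵢ λᵢⁿ ∏_{j ≠ i} (X − λⱼ) satisfy S₀ = C' and X·Sₙ = Sₙ₊₁ + (Σᵢ λᵢⁿ)·C, so (Sₙ)ₙ and (d Aⁿ)ₙ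
-- obey the same recursion; as A is invertible when t_k ≠ 0, they agree for every n ∈ ℤ. Each
-- ∏_{j ≠ i} (X − λⱼ) is monic of degree k − 1, so the top coefficient of Sₙ is Σᵢ λᵢⁿ = G_{k,n}.
-- Characteristic zero is only needed to see that t_k stays nonzero in F, which also makes every
-- root λᵢ nonzero, so that λᵢⁿ is meaningful for negative n.
module Submission where

open import Defs
open import Level using (Level)
open import Data.Nat using (ℕ; suc)
open import Data.Integer using (ℤ; +_)
open import Data.Fin using (Fin; fromℕ)
open import Data.Vec using (Vec; lookup)
open import Relation.Nullary using (¬_)
open import Relation.Binary.PropositionalEquality using (_≡_)

open import Algebra.Solver.Ring.AlmostCommutativeRing
  using (fromCommutativeRing; _-Raw-AlmostCommutative⟶_)
import Algebra.Solver.Ring as RingSolver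
open import Data.Bool using (if_then_else_)
open import Data.Fin as Fin using (toℕ; inject₁)
import Data.Fin.Properties as Fin
open import Data.Fin.Relation.Unary.Top using (View; view; ‵fromℕ; ‵inject₁)
open import Data.Integer as ℤ using (-[1+_]; _⊖_)
import Data.Integer.Properties as ℤ
open import Data.Maybe as Maybe using ()
open import Data.Nat as ℕ using (zero)
import Data.Nat.Properties as ℕ
open import Data.Product using (_,_)
open import Data.Vec as Vec using ([]; _∷_; _∷ʳ_; reverse)
import Data.Vec.Properties as Vec
open import Function.Definitions using (Congruent; Injective)
open import Relation.Binary.Bundles using (Setoid)
open import Relation.Binary.Consequences using (dec⇒weaklyDec)
open import Relation.Binary.PropositionalEquality as ≡ using (cong)
open import Relation.Nullary using (does)
open import Relation.Nullary.Decidable using (dec-true; dec-false)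

module _ {a} {A : Set a} where

  lookup-∷ʳ-inject₁ : ∀ {n} (xs : Vec A n) x i → lookup (xs ∷ʳ x) (inject₁ i) ≡ lookup xs i
  lookup-∷ʳ-inject₁ (y ∷ ys) x Fin.zero    = ≡.refl
  lookup-∷ʳ-inject₁ (y ∷ ys) x (Fin.suc i) = lookup-∷ʳ-inject₁ ys x i

  lookup-reverse-zero : ∀ {n} (xs : Vec A (suc n)) → lookup (reverse xs) Fin.zero ≡ lookup xs (fromℕ n)
  lookup-reverse-zero (x ∷ [])     = ≡.refl
  lookup-reverse-zero (x ∷ y ∷ ys) = begin
    lookup (reverse (x ∷ y ∷ ys)) Fin.zero   ≡⟨ cong (λ v → lookup v Fin.zero) (Vec.reverse-∷ x (y ∷ ys)) ⟩
    lookup (reverse (y ∷ ys) ∷ʳ x) Fin.zero  ≡⟨ lookup-∷ʳ-inject₁ (reverse (y ∷ ys)) x Fin.zero ⟩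
    lookup (reverse (y ∷ ys)) Fin.zero       ≡⟨ lookup-reverse-zero (y ∷ ys) ⟩
    lookup (y ∷ ys) (fromℕ _)                ∎
    where open ≡.≡-Reasoning

lookup-Ccoeffs-inject₁ : ∀ {m} (t : Vec ℤ (suc m)) j →
                         lookup (Ccoeffs t) (inject₁ j) ≡ ℤ.- lookup (reverse t) j
lookup-Ccoeffs-inject₁ t j = begin
  lookup (reverse (+ 1 ∷ Vec.map ℤ.-_ t)) (inject₁ j)
    ≡⟨ cong (λ v → lookup v (inject₁ j)) (Vec.reverse-∷ (+ 1) (Vec.map ℤ.-_ t)) ⟩
  lookup (reverse (Vec.map ℤ.-_ t) ∷ʳ + 1) (inject₁ j)
    ≡⟨ lookup-∷ʳ-inject₁ (reverse (Vec.map ℤ.-_ t)) (+ 1) j ⟩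
  lookup (reverse (Vec.map ℤ.-_ t)) j
    ≡⟨ cong (λ v → lookup v j) (Vec.map-reverse ℤ.-_ t) ⟨
  lookup (Vec.map ℤ.-_ (reverse t)) j
    ≡⟨ Vec.lookup-map j ℤ.-_ (reverse t) ⟩
  ℤ.- lookup (reverse t) j ∎
  where open ≡.≡-Reasoning

lookup-deriv : ∀ {k} (cs : Vec ℤ (suc k)) j → lookup (deriv cs) j ≡ + suc (toℕ j) ℤ.* lookup cs (Fin.suc j)
lookup-deriv (_ ∷ cs) j = Vec.lookup∘tabulate _ j

module _ {a ℓ} (S : Setoid a ℓ) where
  open Setoid S

  orbit-unique : ∀ {f : Carrier → Carrier} → Congruent _≈_ _≈_ f → Injective _≈_ _≈_ f →
                 ∀ {w v : ℤ → Carrier} → w (+ 0) ≈ v (+ 0) →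
                 (∀ n → w (n ℤ.+ + 1) ≈ f (w n)) → (∀ n → v (n ℤ.+ + 1) ≈ f (v n)) →
                 ∀ n → w n ≈ v n
  orbit-unique f-cong f-inj {w} {v} w₀≈v₀ w-step v-step = agree
    where
    forward : ∀ n → w n ≈ v n → w (n ℤ.+ + 1) ≈ v (n ℤ.+ + 1)
    forward n eq = trans (w-step n) (trans (f-cong eq) (sym (v-step n)))

    backward : ∀ n → w (n ℤ.+ + 1) ≈ v (n ℤ.+ + 1) → w n ≈ v n
    backward n eq = f-inj (trans (sym (w-step n)) (trans eq (v-step n)))

    agree : ∀ n → w n ≈ v n
    agree (+ zero)     = w₀≈v₀
    agree (+ suc k)    = ≡.subst (λ n → w n ≈ v n) (cong +_ (ℕ.+-comm k 1)) (forward (+ k) (agree (+ k)))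
    agree -[1+ zero ]  = backward -[1+ zero ] w₀≈v₀
    agree -[1+ suc k ] = backward -[1+ suc k ] (agree -[1+ k ])

module _ {c ℓ : Level} (F : Field c ℓ) where
  open Field F
  open import Algebra.Properties.Ring ring
    using (-‿distribˡ-*; -‿distribʳ-*; -‿involutive; -0#≈0#; +-cancelʳ)
  open import Algebra.Properties.AbelianGroup +-abelianGroup using (⁻¹-∙-comm)
  open import Algebra.Properties.CommutativeSemigroup +-commutativeSemigroup using (interchange)
  open import Algebra.Properties.Semiring.Mult semiring using (_×_; ×-homo-+; ×1-homo-*)
  open import Algebra.Properties.Monoid.Mult.TCOptimised +-monoid
    using () renaming (_×_ to _×′_; ×ᵤ≈× to ×≈×′)
  open import Algebra.Properties.Semiring.Sum semiring
    using (sum; sum-cong-≗; sum-init-last; *-distribʳ-sum)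
  open import Relation.Binary.Reasoning.Setoid setoid

  *-cancelʳ-≉0 : ∀ {a x y} → ¬ (a ≈ 0#) → x * a ≈ y * a → x ≈ y
  *-cancelʳ-≉0 {a} {x} {y} a≉0 xa≈ya = begin
    x                  ≈⟨ *-identityʳ x ⟨
    x * 1#             ≈⟨ *-congˡ (⁻¹-inverseʳ a a≉0) ⟨
    x * (a * a ⁻¹)     ≈⟨ *-assoc x a (a ⁻¹) ⟨
    (x * a) * a ⁻¹     ≈⟨ *-congʳ xa≈ya ⟩
    (y * a) * a ⁻¹     ≈⟨ *-assoc y a (a ⁻¹) ⟩
    y * (a * a ⁻¹)     ≈⟨ *-congˡ (⁻¹-inverseʳ a a≉0) ⟩
    y * 1#             ≈⟨ *-identityʳ y ⟩
    y                  ∎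

  zpow-suc : ∀ {a} → ¬ (a ≈ 0#) → ∀ n → zpow F a (n ℤ.+ + 1) ≈ a * zpow F a n
  zpow-suc {a} a≉0 (+ k)        = reflexive (cong (pow F a) (ℕ.+-comm k 1))
  zpow-suc {a} a≉0 -[1+ zero ]  = sym (trans (*-congˡ (*-identityʳ _)) (⁻¹-inverseʳ a a≉0))
  zpow-suc {a} a≉0 -[1+ suc k ] = begin
    pow F (a ⁻¹) (suc k)                 ≈⟨ *-identityˡ _ ⟨
    1# * pow F (a ⁻¹) (suc k)            ≈⟨ *-congʳ (⁻¹-inverseʳ a a≉0) ⟨
    (a * a ⁻¹) * pow F (a ⁻¹) (suc k)    ≈⟨ *-assoc _ _ _ ⟩
    a * pow F (a ⁻¹) (suc (suc k))       ∎

  natCast≡×1# : ∀ n → natCast F n ≡ n × 1#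
  natCast≡×1# zero    = ≡.refl
  natCast≡×1# (suc n) = cong (_+_ 1#) (natCast≡×1# n)

  natCast-+ : ∀ m n → natCast F (m ℕ.+ n) ≈ natCast F m + natCast F n
  natCast-+ m n = begin
    natCast F (m ℕ.+ n)         ≡⟨ natCast≡×1# (m ℕ.+ n) ⟩
    (m ℕ.+ n) × 1#              ≈⟨ ×-homo-+ 1# m n ⟩
    m × 1# + n × 1#             ≡⟨ ≡.cong₂ _+_ (natCast≡×1# m) (natCast≡×1# n) ⟨
    natCast F m + natCast F n   ∎

  natCast-* : ∀ m n → natCast F (m ℕ.* n) ≈ natCast F m * natCast F n
  natCast-* m n = begin
    natCast F (m ℕ.* n)         ≡⟨ natCast≡×1# (m ℕ.* n) ⟩
    (m ℕ.* n) × 1#              ≈⟨ ×1-homo-* m n ⟩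
    (m × 1#) * (n × 1#)         ≡⟨ ≡.cong₂ _*_ (natCast≡×1# m) (natCast≡×1# n) ⟨
    natCast F m * natCast F n   ∎

  intCast-⊖ : ∀ m n → intCast F (m ⊖ n) ≈ natCast F m - natCast F n
  intCast-⊖ zero    zero    = sym (-‿inverseʳ 0#)
  intCast-⊖ zero    (suc n) = sym (+-identityˡ _)
  intCast-⊖ (suc m) zero    = sym (trans (+-congˡ -0#≈0#) (+-identityʳ _))
  intCast-⊖ (suc m) (suc n) = begin
    intCast F (suc m ⊖ suc n)                   ≡⟨ cong (intCast F) (ℤ.[1+m]⊖[1+n]≡m⊖n m n) ⟩
    intCast F (m ⊖ n)                           ≈⟨ intCast-⊖ m n ⟩
    natCast F m - natCast F n                   ≈⟨ +-identityˡ _ ⟨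
    0# + (natCast F m - natCast F n)            ≈⟨ +-congʳ (-‿inverseʳ 1#) ⟨
    (1# - 1#) + (natCast F m - natCast F n)     ≈⟨ interchange 1# (- 1#) (natCast F m) (- natCast F n) ⟩
    (1# + natCast F m) + (- 1# - natCast F n)   ≈⟨ +-congˡ (⁻¹-∙-comm 1# (natCast F n)) ⟩
    natCast F (suc m) - natCast F (suc n)       ∎

  intCast-+ : ∀ i j → intCast F (i ℤ.+ j) ≈ intCast F i + intCast F j
  intCast-+ (+ m)    (+ n)    = natCast-+ m n
  intCast-+ (+ m)    -[1+ n ] = intCast-⊖ m (suc n)
  intCast-+ -[1+ m ] (+ n)    = trans (intCast-⊖ n (suc m)) (+-comm _ _)
  intCast-+ -[1+ m ] -[1+ n ] = begin
    - natCast F (suc (suc (m ℕ.+ n)))           ≡⟨ cong (λ k → - natCast F (suc k)) (ℕ.+-suc m n) ⟨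
    - natCast F (suc m ℕ.+ suc n)               ≈⟨ -‿cong (natCast-+ (suc m) (suc n)) ⟩
    - (natCast F (suc m) + natCast F (suc n))   ≈⟨ ⁻¹-∙-comm _ _ ⟨
    - natCast F (suc m) - natCast F (suc n)     ∎

  intCast-neg : ∀ i → intCast F (ℤ.- i) ≈ - intCast F i
  intCast-neg (+ zero)  = sym -0#≈0#
  intCast-neg (+ suc n) = refl
  intCast-neg -[1+ n ]  = sym (-‿involutive _)

  intCast-pos-* : ∀ m j → intCast F (+ m ℤ.* j) ≈ natCast F m * intCast F j
  intCast-pos-* m (+ n) = begin
    intCast F (+ m ℤ.* + n)     ≡⟨ cong (intCast F) (ℤ.pos-* m n) ⟨
    natCast F (m ℕ.* n)         ≈⟨ natCast-* m n ⟩
    natCast F m * natCast F n   ∎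
  intCast-pos-* m -[1+ n ] = begin
    intCast F (+ m ℤ.* -[1+ n ])            ≡⟨ cong (intCast F) (ℤ.neg-distribʳ-* (+ m) (+ suc n)) ⟨
    intCast F (ℤ.- (+ m ℤ.* + suc n))       ≈⟨ intCast-neg (+ m ℤ.* + suc n) ⟩
    - intCast F (+ m ℤ.* + suc n)           ≈⟨ -‿cong (intCast-pos-* m (+ suc n)) ⟩
    - (natCast F m * natCast F (suc n))     ≈⟨ -‿distribʳ-* _ _ ⟩
    natCast F m * - natCast F (suc n)       ∎

  intCast-* : ∀ i j → intCast F (i ℤ.* j) ≈ intCast F i * intCast F j
  intCast-* (+ m)    j = intCast-pos-* m j
  intCast-* -[1+ m ] j = begin
    intCast F (-[1+ m ] ℤ.* j)              ≡⟨ cong (intCast F) (ℤ.neg-distribˡ-* (+ suc m) j) ⟨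
    intCast F (ℤ.- (+ suc m ℤ.* j))         ≈⟨ intCast-neg (+ suc m ℤ.* j) ⟩
    - intCast F (+ suc m ℤ.* j)             ≈⟨ -‿cong (intCast-pos-* (suc m) j) ⟩
    - (natCast F (suc m) * intCast F j)     ≈⟨ -‿distribˡ-* _ _ ⟩
    - natCast F (suc m) * intCast F j       ∎

  intCast-≉0 : CharZero F → ∀ {i} → ¬ (i ≡ + 0) → ¬ (intCast F i ≈ 0#)
  intCast-≉0 char0 {+ zero}    i≢0 _  = i≢0 ≡.refl
  intCast-≉0 char0 {+ suc n}   i≢0    = char0 n
  intCast-≉0 char0 { -[1+ n ]} i≢0 eq = char0 n (trans (sym (-‿involutive _)) (trans (-‿cong eq) -0#≈0#))

  -- The solver checks normal forms by refl, so its coefficient map must send + 1 to 1# itself,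
  -- whereas intCast F (+ 1) is 1# + 0#.
  private
    ι : ℤ → Carrier
    ι (+ n)    = n ×′ 1#
    ι -[1+ n ] = - (suc n ×′ 1#)

    ι≈intCast : ∀ i → ι i ≈ intCast F i
    ι≈intCast (+ n)    = trans (sym (×≈×′ n 1#)) (reflexive (≡.sym (natCast≡×1# n)))
    ι≈intCast -[1+ n ] = -‿cong (ι≈intCast (+ suc n))

  ℤ⟶F : ℤ.+-*-rawRing -Raw-AlmostCommutative⟶ fromCommutativeRing commutativeRing
  ℤ⟶F = record
    { ⟦_⟧    = ι
    ; +-homo = λ i j → begin
        ι (i ℤ.+ j)                ≈⟨ ι≈intCast (i ℤ.+ j) ⟩
        intCast F (i ℤ.+ j)        ≈⟨ intCast-+ i j ⟩
        intCast F i + intCast F j  ≈⟨ +-cong (ι≈intCast i) (ι≈intCast j) ⟨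
        ι i + ι j                  ∎
    ; *-homo = λ i j → begin
        ι (i ℤ.* j)                ≈⟨ ι≈intCast (i ℤ.* j) ⟩
        intCast F (i ℤ.* j)        ≈⟨ intCast-* i j ⟩
        intCast F i * intCast F j  ≈⟨ *-cong (ι≈intCast i) (ι≈intCast j) ⟨
        ι i * ι j                  ∎
    ; -‿homo = λ i → begin
        ι (ℤ.- i)                  ≈⟨ ι≈intCast (ℤ.- i) ⟩
        intCast F (ℤ.- i)          ≈⟨ intCast-neg i ⟩
        - intCast F i              ≈⟨ -‿cong (ι≈intCast i) ⟨
        - ι i                      ∎
    ; 0-homo = refl
    ; 1-homo = refl
    }

  open RingSolver ℤ.+-*-rawRing (fromCommutativeRing commutativeRing) ℤ⟶F
    (λ i j → Maybe.map (λ i≡j → reflexive (cong ι i≡j)) (dec⇒weaklyDec ℤ._≟_ i j))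
    using (solve; _:=_; _:+_; _:*_; :-_; con)

  infix 4 _≐_
  infixr 8 X*_ [X-_]*_

  Poly : Set c
  Poly = ℕ → Carrier

  _≐_ : Poly → Poly → Set ℓ
  f ≐ g = ∀ i → f i ≈ g i

  coeff : ∀ {n} → Vec Carrier n → Poly
  coeff []       i       = 0#
  coeff (x ∷ xs) zero    = x
  coeff (x ∷ xs) (suc i) = coeff xs i

  X*_ : Poly → Poly
  (X* f) zero    = 0#
  (X* f) (suc i) = f i

  [X-_]*_ : Carrier → Poly → Poly
  ([X- a ]* f) i = (X* f) i + (- a) * f i

  ∂ : Poly → Poly
  ∂ f i = natCast F (suc i) * f (suc i)

  X*-cong : ∀ {f g} → f ≐ g → X* f ≐ X* g
  X*-cong f≐g zero    = refl
  X*-cong f≐g (suc i) = f≐g i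

  [X-]*-cong : ∀ a {f g} → f ≐ g → [X- a ]* f ≐ [X- a ]* g
  [X-]*-cong a f≐g i = +-cong (X*-cong f≐g i) (*-congˡ (f≐g i))

  coeff-lookup : ∀ {n} (xs : Vec Carrier n) j → coeff xs (toℕ j) ≡ lookup xs j
  coeff-lookup (x ∷ xs) Fin.zero    = ≡.refl
  coeff-lookup (x ∷ xs) (Fin.suc j) = coeff-lookup xs j

  coeff-0#∷ : ∀ {n} (xs : Vec Carrier n) → coeff (0# ∷ xs) ≐ X* coeff xs
  coeff-0#∷ xs zero    = refl
  coeff-0#∷ xs (suc i) = refl

  coeff-∷ʳ-0# : ∀ {n} (xs : Vec Carrier n) → coeff (xs ∷ʳ 0#) ≐ coeff xs
  coeff-∷ʳ-0# []       zero    = refl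
  coeff-∷ʳ-0# []       (suc i) = refl
  coeff-∷ʳ-0# (x ∷ xs) zero    = refl
  coeff-∷ʳ-0# (x ∷ xs) (suc i) = coeff-∷ʳ-0# xs i

  coeff-zipWith-+ : ∀ {n} (xs ys : Vec Carrier n) →
                    coeff (Vec.zipWith _+_ xs ys) ≐ λ i → coeff xs i + coeff ys i
  coeff-zipWith-+ []       []       i       = sym (+-identityˡ 0#)
  coeff-zipWith-+ (x ∷ xs) (y ∷ ys) zero    = refl
  coeff-zipWith-+ (x ∷ xs) (y ∷ ys) (suc i) = coeff-zipWith-+ xs ys i

  coeff-map-* : ∀ {n} a (xs : Vec Carrier n) → coeff (Vec.map (a *_) xs) ≐ λ i → a * coeff xs i
  coeff-map-* a []       i       = sym (zeroʳ a)
  coeff-map-* a (x ∷ xs) zero    = refl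
  coeff-map-* a (x ∷ xs) (suc i) = coeff-map-* a xs i

  coeff-xMinus : ∀ {n} a (p : Vec Carrier (suc n)) → coeff (xMinus F a p) ≐ [X- a ]* coeff p
  coeff-xMinus a p i = begin
    coeff (Vec.zipWith _+_ (0# ∷ p) (Vec.map ((- a) *_) p ∷ʳ 0#)) i
      ≈⟨ coeff-zipWith-+ (0# ∷ p) (Vec.map ((- a) *_) p ∷ʳ 0#) i ⟩
    coeff (0# ∷ p) i + coeff (Vec.map ((- a) *_) p ∷ʳ 0#) i
      ≈⟨ +-cong (coeff-0#∷ p i) (trans (coeff-∷ʳ-0# (Vec.map ((- a) *_) p) i) (coeff-map-* (- a) p i)) ⟩
    ([X- a ]* coeff p) i ∎

  X*-∂ : ∀ f → X* ∂ f ≐ λ i → natCast F i * f i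
  X*-∂ f zero    = sym (zeroˡ _)
  X*-∂ f (suc i) = refl

  ∂-[X-]* : ∀ a f → ∂ ([X- a ]* f) ≐ λ i → f i + ([X- a ]* ∂ f) i
  ∂-[X-]* a f i = begin
    (1# + natCast F i) * (f i + (- a) * f (suc i))
      ≈⟨ leibniz a (natCast F i) (f i) (f (suc i)) ⟩
    f i + (natCast F i * f i + (- a) * ((1# + natCast F i) * f (suc i)))
      ≈⟨ +-congˡ (+-congʳ (X*-∂ f i)) ⟨
    f i + ([X- a ]* ∂ f) i ∎
    where
    leibniz : ∀ a N x y → (1# + N) * (x + (- a) * y) ≈ x + (N * x + (- a) * ((1# + N) * y))
    leibniz = solve 4 (λ a N x y → (con (+ 1) :+ N) :* (x :+ (:- a) :* y)
                                 := x :+ (N :* x :+ (:- a) :* ((con (+ 1) :+ N) :* y))) refl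

  rootPoly : ∀ {k} → Vec Carrier k → Poly
  rootPoly ls = coeff (linProd F ls)

  rootPoly-∷ : ∀ {k} a (ls : Vec Carrier k) → rootPoly (a ∷ ls) ≐ [X- a ]* rootPoly ls
  rootPoly-∷ a ls = coeff-xMinus a (linProd F ls)

  rootPoly-high : ∀ {k} (ls : Vec Carrier k) i → k ℕ.< i → rootPoly ls i ≈ 0#
  rootPoly-high []       (suc i) _           = refl
  rootPoly-high (a ∷ ls) (suc i) (ℕ.s≤s k<i) = begin
    rootPoly (a ∷ ls) (suc i)                     ≈⟨ rootPoly-∷ a ls (suc i) ⟩
    rootPoly ls i + (- a) * rootPoly ls (suc i)   ≈⟨ +-cong (rootPoly-high ls i k<i)
                                                       (*-congˡ (rootPoly-high ls (suc i) (ℕ.m<n⇒m<1+n k<i))) ⟩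
    0# + (- a) * 0#                               ≈⟨ trans (+-identityˡ _) (zeroʳ _) ⟩
    0#                                            ∎

  rootPoly-monic : ∀ {k} (ls : Vec Carrier k) → rootPoly ls k ≈ 1#
  rootPoly-monic []               = refl
  rootPoly-monic {suc k} (a ∷ ls) = begin
    rootPoly (a ∷ ls) (suc k)                     ≈⟨ rootPoly-∷ a ls (suc k) ⟩
    rootPoly ls k + (- a) * rootPoly ls (suc k)   ≈⟨ +-cong (rootPoly-monic ls)
                                                       (*-congˡ (rootPoly-high ls (suc k) ℕ.≤-refl)) ⟩
    1# + (- a) * 0#                               ≈⟨ trans (+-congˡ (zeroʳ _)) (+-identityʳ _) ⟩
    1#                                            ∎

  root≈0⇒rootPoly₀≈0 : ∀ {k} (ls : Vec Carrier k) i → lookup ls i ≈ 0# → rootPoly ls 0 ≈ 0#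
  root≈0⇒rootPoly₀≈0 (a ∷ ls) i λᵢ≈0 = begin
    rootPoly (a ∷ ls) 0          ≈⟨ rootPoly-∷ a ls 0 ⟩
    0# + (- a) * rootPoly ls 0   ≈⟨ +-identityˡ _ ⟩
    (- a) * rootPoly ls 0        ≈⟨ product≈0 i λᵢ≈0 ⟩
    0#                           ∎
    where
    product≈0 : ∀ i → lookup (a ∷ ls) i ≈ 0# → (- a) * rootPoly ls 0 ≈ 0#
    product≈0 Fin.zero    a≈0  = trans (*-congʳ (trans (-‿cong a≈0) -0#≈0#)) (zeroˡ _)
    product≈0 (Fin.suc i) λᵢ≈0 = trans (*-congˡ (root≈0⇒rootPoly₀≈0 ls i λᵢ≈0)) (zeroʳ _)

  -- Sₙ = Σᵢ λᵢⁿ ∏_{j ≠ i} (X − λⱼ)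
  cofactorSum : ∀ {k} → Vec Carrier k → ℤ → Poly
  cofactorSum []       n i = 0#
  cofactorSum (a ∷ ls) n i = zpow F a n * rootPoly ls i + ([X- a ]* cofactorSum ls n) i

  cofactorSum-high : ∀ {k} (ls : Vec Carrier k) n i → k ℕ.≤ i → cofactorSum ls n i ≈ 0#
  cofactorSum-high []       n i       _           = refl
  cofactorSum-high (a ∷ ls) n (suc i) (ℕ.s≤s k≤i) = begin
    zpow F a n * rootPoly ls (suc i) + (cofactorSum ls n i + (- a) * cofactorSum ls n (suc i))
      ≈⟨ +-cong (*-congˡ (rootPoly-high ls (suc i) (ℕ.s≤s k≤i)))
                (+-cong (cofactorSum-high ls n i k≤i)
                        (*-congˡ (cofactorSum-high ls n (suc i) (ℕ.m≤n⇒m≤1+n k≤i)))) ⟩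
    zpow F a n * 0# + (0# + (- a) * 0#)
      ≈⟨ +-cong (zeroʳ _) (trans (+-identityˡ _) (zeroʳ _)) ⟩
    0# + 0#
      ≈⟨ +-identityʳ 0# ⟩
    0# ∎

  cofactorSum-top : ∀ {m} (ls : Vec Carrier (suc m)) n → cofactorSum ls n m ≈ powerSum F ls n
  cofactorSum-top {m} (a ∷ ls) n = begin
    zpow F a n * rootPoly ls m + ((X* cofactorSum ls n) m + (- a) * cofactorSum ls n m)
      ≈⟨ +-cong (*-congˡ (rootPoly-monic ls))
                (+-cong (X*-top ls) (*-congˡ (cofactorSum-high ls n m ℕ.≤-refl))) ⟩
    zpow F a n * 1# + (powerSum F ls n + (- a) * 0#)
      ≈⟨ +-cong (*-identityʳ _) (trans (+-congˡ (zeroʳ _)) (+-identityʳ _)) ⟩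
    zpow F a n + powerSum F ls n ∎
    where
    X*-top : ∀ {m} (ls : Vec Carrier m) → (X* cofactorSum ls n) m ≈ powerSum F ls n
    X*-top []       = refl
    X*-top (b ∷ bs) = cofactorSum-top (b ∷ bs) n

  cofactorSum-zero : ∀ {k} (ls : Vec Carrier k) → cofactorSum ls (+ 0) ≐ ∂ (rootPoly ls)
  cofactorSum-zero []       i = sym (zeroʳ _)
  cofactorSum-zero (a ∷ ls) i = begin
    1# * rootPoly ls i + ([X- a ]* cofactorSum ls (+ 0)) i
      ≈⟨ +-cong (*-identityˡ _) ([X-]*-cong a (cofactorSum-zero ls) i) ⟩
    rootPoly ls i + ([X- a ]* ∂ (rootPoly ls)) i
      ≈⟨ ∂-[X-]* a (rootPoly ls) i ⟨
    ∂ ([X- a ]* rootPoly ls) i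
      ≈⟨ *-congˡ (rootPoly-∷ a ls (suc i)) ⟨
    ∂ (rootPoly (a ∷ ls)) i ∎

  X*-cofactorSum : ∀ {k} (ls : Vec Carrier k) → (∀ i → ¬ (lookup ls i ≈ 0#)) → ∀ n →
                   X* cofactorSum ls n ≐ λ i → cofactorSum ls (n ℤ.+ + 1) i + powerSum F ls n * rootPoly ls i
  X*-cofactorSum []       _  n zero    = sym (trans (+-identityˡ _) (zeroˡ _))
  X*-cofactorSum []       _  n (suc i) = sym (trans (+-identityˡ _) (zeroˡ _))
  X*-cofactorSum (a ∷ ls) ≉0 n i = trans (lhs-expanded i) (sym (rhs-expanded i))
    where
    z p : Carrier
    z = zpow F a n
    p = powerSum F ls n

    P S S′ : Poly
    P  = rootPoly ls
    S  = cofactorSum ls n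
    S′ = cofactorSum ls (n ℤ.+ + 1)

    IH : X* S ≐ λ i → S′ i + p * P i
    IH = X*-cofactorSum ls (λ i → ≉0 (Fin.suc i)) n

    rhs-expanded : ∀ i → cofactorSum (a ∷ ls) (n ℤ.+ + 1) i + (z + p) * rootPoly (a ∷ ls) i
                         ≈ (a * z) * P i + ([X- a ]* S′) i + (z + p) * ([X- a ]* P) i
    rhs-expanded i = +-cong (+-congʳ (*-congʳ (zpow-suc (≉0 Fin.zero) n))) (*-congˡ (rootPoly-∷ a ls i))

    lhs-expanded : ∀ i → (X* cofactorSum (a ∷ ls) n) i
                         ≈ (a * z) * P i + ([X- a ]* S′) i + (z + p) * ([X- a ]* P) i
    lhs-expanded zero = begin
      0#                                                                   ≈⟨ zeroʳ _ ⟨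
      (- a) * 0#                                                           ≈⟨ *-congˡ (IH 0) ⟩
      (- a) * (S′ 0 + p * P 0)                                             ≈⟨ at-zero a z p (P 0) (S′ 0) ⟩
      (a * z) * P 0 + (0# + (- a) * S′ 0) + (z + p) * (0# + (- a) * P 0)   ∎
      where
      at-zero : ∀ a z p P₀ S₀ →
                (- a) * (S₀ + p * P₀) ≈ (a * z) * P₀ + (0# + (- a) * S₀) + (z + p) * (0# + (- a) * P₀)
      at-zero = solve 5 (λ a z p P₀ S₀ →
                  (:- a) :* (S₀ :+ p :* P₀)
                  := (a :* z) :* P₀ :+ (con (+ 0) :+ (:- a) :* S₀) :+ (z :+ p) :* (con (+ 0) :+ (:- a) :* P₀)) refl
    lhs-expanded (suc i) = begin
      z * P i + ((X* S) i + (- a) * S i)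
        ≈⟨ +-congˡ (+-cong (IH i) (*-congˡ (IH (suc i)))) ⟩
      z * P i + ((S′ i + p * P i) + (- a) * (S′ (suc i) + p * P (suc i)))
        ≈⟨ at-suc a z p (P i) (P (suc i)) (S′ i) (S′ (suc i)) ⟩
      (a * z) * P (suc i) + (S′ i + (- a) * S′ (suc i)) + (z + p) * (P i + (- a) * P (suc i)) ∎
      where
      at-suc : ∀ a z p Pᵢ Pᵢ₊₁ Sᵢ Sᵢ₊₁ →
               z * Pᵢ + ((Sᵢ + p * Pᵢ) + (- a) * (Sᵢ₊₁ + p * Pᵢ₊₁))
               ≈ (a * z) * Pᵢ₊₁ + (Sᵢ + (- a) * Sᵢ₊₁) + (z + p) * (Pᵢ + (- a) * Pᵢ₊₁)
      at-suc = solve 7 (λ a z p Pᵢ Pᵢ₊₁ Sᵢ Sᵢ₊₁ →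
                 z :* Pᵢ :+ ((Sᵢ :+ p :* Pᵢ) :+ (:- a) :* (Sᵢ₊₁ :+ p :* Pᵢ₊₁))
                 := (a :* z) :* Pᵢ₊₁ :+ (Sᵢ :+ (:- a) :* Sᵢ₊₁) :+ (z :+ p) :* (Pᵢ :+ (:- a) :* Pᵢ₊₁)) refl

  cofactorOrbit : ∀ {m} → Vec Carrier (suc m) → ℤ → Fin (suc m) → Carrier
  cofactorOrbit ls n j = cofactorSum ls n (toℕ j)

  cofactorOrbit-top : ∀ {m} (ls : Vec Carrier (suc m)) n → cofactorOrbit ls n (fromℕ m) ≈ powerSum F ls n
  cofactorOrbit-top {m} ls n = trans (reflexive (cong (cofactorSum ls n) (Fin.toℕ-fromℕ m))) (cofactorSum-top ls n)

  sumFin≡sum : ∀ {n} (f : Fin n → Carrier) → sumFin F f ≡ sum f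
  sumFin≡sum {zero}  f = ≡.refl
  sumFin≡sum {suc n} f = cong (_+_ (f Fin.zero)) (sumFin≡sum (λ i → f (Fin.suc i)))

  sum-*0# : ∀ {n} (f : Fin n → Carrier) → sum (λ i → f i * 0#) ≈ 0#
  sum-*0# f = trans (sym (*-distribʳ-sum 0# f)) (zeroʳ _)

  δ : ∀ {n} → Fin n → Fin n → Carrier
  δ j i = if does (toℕ j ℕ.≟ toℕ i) then 1# else 0#

  sum-*δ : ∀ {n} (f : Fin n → Carrier) j → sum (λ i → f i * δ j i) ≈ f j
  sum-*δ f Fin.zero    = trans (+-cong (*-identityʳ _) (sum-*0# (λ i → f (Fin.suc i)))) (+-identityʳ _)
  sum-*δ f (Fin.suc j) = trans (+-cong (zeroʳ _) (sum-*δ (λ i → f (Fin.suc i)) j)) (+-identityˡ _)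

  shiftUp : ∀ {m} → (Fin (suc m) → Carrier) → Fin (suc m) → Carrier
  shiftUp u Fin.zero    = 0#
  shiftUp u (Fin.suc j) = u (inject₁ j)

  module _ {m : ℕ} (t : Vec ℤ (suc m)) where

    lastRow : Fin (suc m) → Carrier
    lastRow j = intCast F (lookup (reverse t) j)

    -- X · u mod C for u of degree < k, since Xᵏ ≡ t₁ Xᵏ⁻¹ + … + t_k.
    mulXmod : (Fin (suc m) → Carrier) → Fin (suc m) → Carrier
    mulXmod u j = shiftUp u j + u (fromℕ m) * lastRow j

    companion-fromℕ : ∀ j → companion F t (fromℕ m) j ≡ lastRow j
    companion-fromℕ j
      rewrite dec-true (suc (toℕ (fromℕ m)) ℕ.≟ suc m) (cong suc (Fin.toℕ-fromℕ m)) = ≡.refl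

    companion-inject₁ : ∀ i j → companion F t (inject₁ i) j ≡ (if does (toℕ j ℕ.≟ suc (toℕ i)) then 1# else 0#)
    companion-inject₁ i j
      rewrite Fin.toℕ-inject₁ i
            | dec-false (suc (toℕ i) ℕ.≟ suc m) (λ eq → ℕ.<⇒≢ (Fin.toℕ<n i) (ℕ.suc-injective eq)) = ≡.refl

    rowMul-companion : ∀ u j → rowMul F u (companion F t) j ≈ mulXmod u j
    rowMul-companion u j = begin
      sumFin F (λ i → u i * companion F t i j)
        ≡⟨ sumFin≡sum (λ i → u i * companion F t i j) ⟩
      sum (λ i → u i * companion F t i j)
        ≈⟨ sum-init-last (λ i → u i * companion F t i j) ⟩
      sum (λ i → u (inject₁ i) * companion F t (inject₁ i) j) + u (fromℕ m) * companion F t (fromℕ m) j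
        ≈⟨ +-cong (upper-rows j) (*-congˡ (reflexive (companion-fromℕ j))) ⟩
      mulXmod u j ∎
      where
      upper-rows : ∀ j → sum (λ i → u (inject₁ i) * companion F t (inject₁ i) j) ≈ shiftUp u j
      upper-rows Fin.zero = begin
        sum (λ i → u (inject₁ i) * companion F t (inject₁ i) Fin.zero)
          ≡⟨ sum-cong-≗ (λ i → cong (u (inject₁ i) *_) (companion-inject₁ i Fin.zero)) ⟩
        sum (λ i → u (inject₁ i) * 0#)
          ≈⟨ sum-*0# (λ i → u (inject₁ i)) ⟩
        0# ∎
      upper-rows (Fin.suc j) = begin
        sum (λ i → u (inject₁ i) * companion F t (inject₁ i) (Fin.suc j))
          ≡⟨ sum-cong-≗ (λ i → cong (u (inject₁ i) *_) (companion-inject₁ i (Fin.suc j))) ⟩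
        sum (λ i → u (inject₁ i) * δ j i)
          ≈⟨ sum-*δ (λ i → u (inject₁ i)) j ⟩
        u (inject₁ j) ∎

    mulXmod-cong : ∀ {u v} → (∀ j → u j ≈ v j) → ∀ j → mulXmod u j ≈ mulXmod v j
    mulXmod-cong u≈v Fin.zero    = +-congˡ (*-congʳ (u≈v (fromℕ m)))
    mulXmod-cong u≈v (Fin.suc j) = +-cong (u≈v (inject₁ j)) (*-congʳ (u≈v (fromℕ m)))

    mulXmod-injective : ¬ (lastRow Fin.zero ≈ 0#) →
                        ∀ {u v} → (∀ j → mulXmod u j ≈ mulXmod v j) → ∀ j → u j ≈ v j
    mulXmod-injective tₖ≉0 {u} {v} eq j = agree (view j)
      where
      top-agrees : u (fromℕ m) ≈ v (fromℕ m)
      top-agrees = *-cancelʳ-≉0 tₖ≉0 (trans (sym (+-identityˡ _)) (trans (eq Fin.zero) (+-identityˡ _)))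

      agree : ∀ {j} → View j → u j ≈ v j
      agree ‵fromℕ       = top-agrees
      agree (‵inject₁ i) = +-cancelʳ _ _ _ (trans (eq (Fin.suc i)) (+-congˡ (*-congʳ (sym top-agrees))))

  module _ {m : ℕ} (t : Vec ℤ (suc m)) (ls : Vec Carrier (suc m)) (roots : IsRootVector F t ls) where

    rootPoly-Ccoeffs : ∀ j → rootPoly ls (toℕ j) ≈ intCast F (lookup (Ccoeffs t) j)
    rootPoly-Ccoeffs j = trans (reflexive (coeff-lookup (linProd F ls) j)) (roots j)

    rootPoly≈-lastRow : ∀ j → rootPoly ls (toℕ j) ≈ - lastRow t j
    rootPoly≈-lastRow j = begin
      rootPoly ls (toℕ j)                          ≡⟨ cong (rootPoly ls) (Fin.toℕ-inject₁ j) ⟨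
      rootPoly ls (toℕ (inject₁ j))                ≈⟨ rootPoly-Ccoeffs (inject₁ j) ⟩
      intCast F (lookup (Ccoeffs t) (inject₁ j))   ≡⟨ cong (intCast F) (lookup-Ccoeffs-inject₁ t j) ⟩
      intCast F (ℤ.- lookup (reverse t) j)         ≈⟨ intCast-neg (lookup (reverse t) j) ⟩
      - lastRow t j                                ∎

    roots-≉0 : ¬ (lastRow t Fin.zero ≈ 0#) → ∀ i → ¬ (lookup ls i ≈ 0#)
    roots-≉0 tₖ≉0 i λᵢ≈0 = tₖ≉0 (begin
      lastRow t Fin.zero       ≈⟨ -‿involutive _ ⟨
      - - lastRow t Fin.zero   ≈⟨ -‿cong (rootPoly≈-lastRow Fin.zero) ⟨
      - rootPoly ls 0          ≈⟨ -‿cong (root≈0⇒rootPoly₀≈0 ls i λᵢ≈0) ⟩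
      - 0#                     ≈⟨ -0#≈0# ⟩
      0#                       ∎)

    cofactorOrbit-zero : ∀ j → cofactorOrbit ls (+ 0) j ≈ intCast F (lookup (deriv (Ccoeffs t)) j)
    cofactorOrbit-zero j = begin
      cofactorSum ls (+ 0) (toℕ j)
        ≈⟨ cofactorSum-zero ls (toℕ j) ⟩
      natCast F (suc (toℕ j)) * rootPoly ls (suc (toℕ j))
        ≈⟨ *-congˡ (rootPoly-Ccoeffs (Fin.suc j)) ⟩
      natCast F (suc (toℕ j)) * intCast F (lookup (Ccoeffs t) (Fin.suc j))
        ≈⟨ intCast-pos-* (suc (toℕ j)) (lookup (Ccoeffs t) (Fin.suc j)) ⟨
      intCast F (+ suc (toℕ j) ℤ.* lookup (Ccoeffs t) (Fin.suc j))
        ≡⟨ cong (intCast F) (lookup-deriv (Ccoeffs t) j) ⟨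
      intCast F (lookup (deriv (Ccoeffs t)) j) ∎

    cofactorOrbit-suc : (∀ i → ¬ (lookup ls i ≈ 0#)) →
                        ∀ n j → cofactorOrbit ls (n ℤ.+ + 1) j ≈ mulXmod t (cofactorOrbit ls n) j
    cofactorOrbit-suc ≉0 n j = begin
      S′ j
        ≈⟨ move (S′ j) p (lastRow t j) ⟩
      (S′ j + p * - lastRow t j) + p * lastRow t j
        ≈⟨ +-cong (+-congˡ (*-congˡ (rootPoly≈-lastRow j))) (*-congʳ (cofactorOrbit-top ls n)) ⟨
      (S′ j + p * rootPoly ls (toℕ j)) + cofactorOrbit ls n (fromℕ m) * lastRow t j
        ≈⟨ +-congʳ (X*-cofactorSum ls ≉0 n (toℕ j)) ⟨
      (X* cofactorSum ls n) (toℕ j) + cofactorOrbit ls n (fromℕ m) * lastRow t j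
        ≡⟨ cong (_+ cofactorOrbit ls n (fromℕ m) * lastRow t j) (X*-toℕ j) ⟩
      mulXmod t (cofactorOrbit ls n) j ∎
      where
      p : Carrier
      p = powerSum F ls n

      S′ : Fin (suc m) → Carrier
      S′ = cofactorOrbit ls (n ℤ.+ + 1)

      move : ∀ x p y → x ≈ (x + p * - y) + p * y
      move = solve 3 (λ x p y → x := (x :+ p :* (:- y)) :+ p :* y) refl

      X*-toℕ : ∀ j → (X* cofactorSum ls n) (toℕ j) ≡ shiftUp (cofactorOrbit ls n) j
      X*-toℕ Fin.zero    = ≡.refl
      X*-toℕ (Fin.suc j) = cong (cofactorSum ls n) (≡.sym (Fin.toℕ-inject₁ j))

proposition5p4 : ∀ {c ℓ : Level} (F : Field c ℓ) → CharZero F →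
    (m : ℕ) (t : Vec ℤ (suc m)) → ¬ (lookup t (fromℕ m) ≡ + 0) →
    (ls : Vec (Field.Carrier F) (suc m)) → IsRootVector F t ls →
    (w : ℤ → Fin (suc m) → Field.Carrier F) → IsOrbit F t w →
    ∀ (n : ℤ) → Field._≈_ F (w n (fromℕ m)) (powerSum F ls n)
proposition5p4 F char0 m t tₖ≢0 ls roots w (w₀ , w-step) n =
  trans (w≈cofactorOrbit n (fromℕ m)) (cofactorOrbit-top F ls n)
  where
  open Field F
  open import Data.Vec.Functional.Relation.Binary.Equality.Setoid setoid using (≋-setoid)

  tₖ≉0 : ¬ (lastRow F t Fin.zero ≈ 0#)
  tₖ≉0 = intCast-≉0 F char0 (λ eq → tₖ≢0 (≡.trans (≡.sym (lookup-reverse-zero t)) eq))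

  w≈cofactorOrbit : ∀ n j → w n j ≈ cofactorOrbit F ls n j
  w≈cofactorOrbit = orbit-unique (≋-setoid (suc m)) (mulXmod-cong F t) (mulXmod-injective F t tₖ≉0)
    (λ j → trans (w₀ j) (sym (cofactorOrbit-zero F t ls roots j)))
    (λ n j → trans (w-step n j) (rowMul-companion F t (w n) j))
    (cofactorOrbit-suc F t ls roots (roots-≉0 F t ls roots tₖ≉0))
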